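{- Let $q$ be a prime power and let $\mathcal{B}$ be a minimal blocking set in $\mathrm{PG}(2,q)$ which has the $r_\infty$-property with respect to a point $P\in\mathcal{B}$, with $r_\infty$ the unique tangent to $\mathcal{B}$ through $P$. Then $\mathcal{B}'=\mathcal{B}\setminus\{P\}$ is a minimal blocking set of the affine plane $\mathrm{AG}(2,q)=\mathrm{PG}(2,q)\setminus r_\infty$.
   Context: A blocking set of $\mathrm{PG}(2,q)$ is a set of points meeting every line and containing no line; minimal if no proper subset is a blocking set. For a line $r$ of $\mathrm{PG}(2,q)$, the affine plane $\mathrm{PG}(2,q)\setminus r$ has as points the points not on $r$ and as lines the lines other than $r$ (restricted to these points), with the induced incidence. A blocking set of an affine plane is a set of points meeting every affine line (it may contain lines); minimal if no proper subset is a blocking set. A line is tangent to a point set $\mathcal{K}$ if it meets $\mathcal{K}$ in exactly one point, secant if in more than one. $\mathcal{B}$ has the $r_\infty$-property with respect to $P\in\mathcal{B}$ if exactly one line through $P$ is tangent to $\mathcal{B}$ (called $r_\infty$) and all other lines through $P$ are secants. -}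

module Defs where

open import Level using (Level; _⊔_; suc)
open import Algebra.Bundles using (CommutativeRing)
open import Data.Nat using (ℕ)
open import Data.Fin using (Fin)
open import Data.Bool using (Bool; true; false; _∧_; not)
open import Data.Product using (Σ; ∃; _×_; _,_)
open import Relation.Nullary using (¬_; Dec; yes; no)
open import Relation.Nullary.Decidable using (⌊_⌋)
open import Relation.Binary.Definitions using (Decidable)
open import Relation.Binary.PropositionalEquality using (_≡_)
open import Data.Empty using (⊥)
open import Data.Unit using (⊤)
import Data.Unit

-- A finite field of order q (the stdlib has no Field bundle): a commutative
-- ring with decidable equality, 0 ≠ 1, multiplicative inverses of nonzero
-- elements, and a bijective enumeration Fin q → Carrier (up to ≈).
-- (Every finite field has prime-power order q and GF(q) is unique.)
record FiniteField (c ℓ : Level) : Set (suc (c ⊔ ℓ)) where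
  field
    commRing : CommutativeRing c ℓ
  open CommutativeRing commRing public
  field
    _≟_      : Decidable _≈_
    0≉1      : ¬ (0# ≈ 1#)
    inverse  : ∀ x → ¬ (x ≈ 0#) → ∃ λ y → (x * y) ≈ 1#
    q        : ℕ
    enum     : Fin q → Carrier
    enum-surj : ∀ x → ∃ λ i → enum i ≈ x
    enum-inj  : ∀ i j → enum i ≈ enum j → i ≡ j

module PG {c ℓ : Level} (F : FiniteField c ℓ) where
  open FiniteField F

  -- Points of PG(2,F) = 1-dim subspaces of F³, given by their unique
  -- normalised representative: (1,x,y), (0,1,x) or (0,0,1).
  data Pt : Set c where
    p1 : Carrier → Carrier → Pt
    p2 : Carrier → Pt
    p3 : Pt

  -- Lines are dual: [a,b,c] normalised the same way.
  Line : Set c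
  Line = Pt

  coords : Pt → Carrier × Carrier × Carrier
  coords (p1 x y) = 1# , x , y
  coords (p2 x)   = 0# , 1# , x
  coords p3       = 0# , 0# , 1#

  _≈P_ : Pt → Pt → Set ℓ
  p1 x y ≈P p1 x' y' = (x ≈ x') × (y ≈ y')
  p2 x   ≈P p2 x'    = x ≈ x'
  p3     ≈P p3       = Level.Lift ℓ ⊤
  _      ≈P _        = Level.Lift ℓ ⊥

  _≟P_ : (P Q : Pt) → Dec (P ≈P Q)
  p1 x y ≟P p1 x' y' with x ≟ x' | y ≟ y'
  ... | yes a | yes b = yes (a , b)
  ... | no a  | _     = no (λ { (a' , _) → a a' })
  ... | yes _ | no b  = no (λ { (_ , b') → b b' })
  p2 x ≟P p2 x' = x ≟ x'
  p3 ≟P p3 = yes (Level.lift Data.Unit.tt)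
  p1 _ _ ≟P p2 _ = no (λ ())
  p1 _ _ ≟P p3   = no (λ ())
  p2 _ ≟P p1 _ _ = no (λ ())
  p2 _ ≟P p3     = no (λ ())
  p3 ≟P p1 _ _   = no (λ ())
  p3 ≟P p2 _     = no (λ ())

  _on_ : Pt → Line → Set ℓ
  P on L with coords P | coords L
  ... | (x0 , x1 , x2) | (a0 , a1 , a2) = ((a0 * x0) + (a1 * x1)) + (a2 * x2) ≈ 0#

  PSet : Set c
  PSet = Pt → Bool

  Respects : PSet → Set (c ⊔ ℓ)
  Respects S = ∀ P Q → P ≈P Q → S P ≡ S Q

  _⊆_ : PSet → PSet → Set c
  S ⊆ T = ∀ P → S P ≡ true → T P ≡ true

  Meets : PSet → Line → Set (c ⊔ ℓ)
  Meets S L = ∃ λ P → P on L × S P ≡ true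

  ContainsLine : PSet → Set (c ⊔ ℓ)
  ContainsLine S = ∃ λ L → ∀ P → P on L → S P ≡ true

  Blocking : PSet → Set (c ⊔ ℓ)
  Blocking S = (∀ L → Meets S L) × ¬ ContainsLine S

  Minimal : PSet → Set (c ⊔ ℓ)
  Minimal B = Blocking B ×
    (∀ (S : PSet) → Respects S → S ⊆ B → Blocking S → B ⊆ S)

  Tangent : PSet → Line → Set (c ⊔ ℓ)
  Tangent S L = ∃ λ P → (P on L × S P ≡ true) ×
                  (∀ Q → Q on L → S Q ≡ true → Q ≈P P)

  Secant : PSet → Line → Set (c ⊔ ℓ)
  Secant S L = ∃ λ P → ∃ λ Q → ¬ (P ≈P Q) ×
                 (P on L × S P ≡ true) × (Q on L × S Q ≡ true)

  -- r∞-property of B w.r.t. P ∈ B, with r the tangent through P: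
  -- r is a tangent through P, and every other line through P is a secant
  -- (so r is the unique tangent through P).
  RInftyProperty : PSet → Pt → Line → Set (c ⊔ ℓ)
  RInftyProperty B P r = P on r × Tangent B r ×
    (∀ L → P on L → ¬ (L ≈P r) → Secant B L)

  remove : PSet → Pt → PSet
  remove B P Q = B Q ∧ not ⌊ Q ≟P P ⌋

  -- Affine plane PG(2,q) \ r: points not on r, lines other than r.
  AffPoints : Line → PSet → Set (c ⊔ ℓ)
  AffPoints r S = ∀ P → S P ≡ true → ¬ (P on r)

  AffBlocking : Line → PSet → Set (c ⊔ ℓ)
  AffBlocking r S = AffPoints r S ×
    (∀ L → ¬ (L ≈P r) → ∃ λ P → P on L × ¬ (P on r) × S P ≡ true)

  AffMinimal : Line → PSet → Set (c ⊔ ℓ)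
  AffMinimal r B = AffBlocking r B ×
    (∀ (S : PSet) → Respects S → S ⊆ B → AffBlocking r S → B ⊆ S)

-- B ∖ {P} has no point on r∞, since r∞ meets B only in P. An affine line L
-- meets B; if only in P, then L passes through P and is not r∞, so it is a
-- secant and meets B in a second point. Conversely, if S ⊆ B ∖ {P} blocks
-- every affine line, then S ∪ {P} blocks every projective line (r∞ in P)
-- and contains no line, being a subset of B; minimality of B forces
-- B ⊆ S ∪ {P}, that is B ∖ {P} ⊆ S.
module Submission where

open import Defs
open import Level using (Level; lift)
open import Data.Bool using (true; false; _∨_)
open import Data.Bool.Properties using (∨-zeroʳ)
open import Data.Empty using (⊥-elim)
open import Data.Product using (_×_; _,_; proj₁)
open import Data.Product.Relation.Binary.Pointwise.NonDependent using (Pointwise)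
open import Data.Sum using (_⊎_; inj₁; inj₂)
open import Data.Unit using (tt)
open import Relation.Nullary using (¬_; yes; no)
open import Relation.Nullary.Decidable using (⌊_⌋)
open import Relation.Binary.PropositionalEquality as ≡ using (_≡_)

module Projective {c ℓ : Level} (F : FiniteField c ℓ) where
  open FiniteField F
  open PG F

  Vec3 : Set c
  Vec3 = Carrier × Carrier × Carrier

  _≈³_ : Vec3 → Vec3 → Set ℓ
  _≈³_ = Pointwise _≈_ (Pointwise _≈_ _≈_)

  _·_ : Vec3 → Vec3 → Carrier
  (a₀ , a₁ , a₂) · (x₀ , x₁ , x₂) = a₀ * x₀ + a₁ * x₁ + a₂ * x₂

  ≈³-refl : ∀ {u} → u ≈³ u
  ≈³-refl = refl , refl , refl

  ·-cong : ∀ {u u′ v v′} → u ≈³ u′ → v ≈³ v′ → u · v ≈ u′ · v′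
  ·-cong (a₀ , a₁ , a₂) (x₀ , x₁ , x₂) =
    +-cong (+-cong (*-cong a₀ x₀) (*-cong a₁ x₁)) (*-cong a₂ x₂)

  coords-cong : ∀ P Q → P ≈P Q → coords P ≈³ coords Q
  coords-cong (p1 _ _) (p1 _ _) (x , y) = refl , x , y
  coords-cong (p2 _)   (p2 _)   x       = refl , refl , x
  coords-cong p3       p3       _       = ≈³-refl

  ≈P-refl : ∀ P → P ≈P P
  ≈P-refl (p1 _ _) = refl , refl
  ≈P-refl (p2 _)   = refl
  ≈P-refl p3       = lift tt

  ≈P-sym : ∀ P Q → P ≈P Q → Q ≈P P
  ≈P-sym (p1 _ _) (p1 _ _) (x , y) = sym x , sym y
  ≈P-sym (p2 _)   (p2 _)   x       = sym x
  ≈P-sym p3       p3       t       = t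

  ≈P-trans : ∀ P Q R → P ≈P Q → Q ≈P R → P ≈P R
  ≈P-trans (p1 _ _) (p1 _ _) (p1 _ _) (x , y) (x′ , y′) = trans x x′ , trans y y′
  ≈P-trans (p2 _)   (p2 _)   (p2 _)   x       x′        = trans x x′
  ≈P-trans p3       p3       p3       t       _         = t

  -- Record eta makes  P on L  definitionally  coords L · coords P ≈ 0#.
  on-respˡ : ∀ P Q L → P ≈P Q → P on L → Q on L
  on-respˡ P Q L P≈Q P∈L = trans (sym (·-cong ≈³-refl (coords-cong P Q P≈Q))) P∈L

  on-respʳ : ∀ P L M → L ≈P M → P on L → P on M
  on-respʳ P L M L≈M P∈L = trans (sym (·-cong (coords-cong L M L≈M) ≈³-refl)) P∈L

  ≟P-congˡ : ∀ P X Y → X ≈P Y → ⌊ X ≟P P ⌋ ≡ ⌊ Y ≟P P ⌋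
  ≟P-congˡ P X Y X≈Y with X ≟P P | Y ≟P P
  ... | yes _   | yes _   = ≡.refl
  ... | no _    | no _    = ≡.refl
  ... | yes X≈P | no Y≉P  = ⊥-elim (Y≉P (≈P-trans Y X P (≈P-sym X Y X≈Y) X≈P))
  ... | no X≉P  | yes Y≈P = ⊥-elim (X≉P (≈P-trans X Y P X≈Y Y≈P))

  Tangent-unique : ∀ S L P Q → Tangent S L →
    P on L → S P ≡ true → Q on L → S Q ≡ true → P ≈P Q
  Tangent-unique S L P Q (R , _ , unique) P∈L P∈S Q∈L Q∈S =
    ≈P-trans P R Q (unique P P∈L P∈S) (≈P-sym Q R (unique Q Q∈L Q∈S))

  ¬ContainsLine-⊆ : ∀ {S T} → S ⊆ T → ¬ ContainsLine T → ¬ ContainsLine S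
  ¬ContainsLine-⊆ S⊆T noLine (L , L⊆S) = noLine (L , λ X X∈L → S⊆T X (L⊆S X X∈L))

  module _ (B : PSet) (P : Pt) where

    remove⁺ : ∀ Q → B Q ≡ true → ¬ (Q ≈P P) → remove B P Q ≡ true
    remove⁺ Q Q∈B Q≉P with Q ≟P P
    ... | yes Q≈P = ⊥-elim (Q≉P Q≈P)
    ... | no _    rewrite Q∈B = ≡.refl

    remove⁻ : ∀ Q → remove B P Q ≡ true → B Q ≡ true × ¬ (Q ≈P P)
    remove⁻ Q Q∈B′ with B Q | Q ≟P P
    ... | true | no Q≉P = ≡.refl , Q≉P

    remove-⊆ : remove B P ⊆ B
    remove-⊆ Q Q∈B′ = proj₁ (remove⁻ Q Q∈B′)

    Secant-remove : ∀ L → Secant B L → Meets (remove B P) L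
    Secant-remove L (Q₁ , Q₂ , Q₁≉Q₂ , (Q₁∈L , Q₁∈B) , (Q₂∈L , Q₂∈B)) with Q₁ ≟P P
    ... | no Q₁≉P  = Q₁ , Q₁∈L , remove⁺ Q₁ Q₁∈B Q₁≉P
    ... | yes Q₁≈P = Q₂ , Q₂∈L , remove⁺ Q₂ Q₂∈B
                       (λ Q₂≈P → Q₁≉Q₂ (≈P-trans Q₁ P Q₂ Q₁≈P (≈P-sym Q₂ P Q₂≈P)))

    Meets-remove : ∀ L → Meets B L → (P on L → Secant B L) → Meets (remove B P) L
    Meets-remove L (Q , Q∈L , Q∈B) secant with Q ≟P P
    ... | no Q≉P  = Q , Q∈L , remove⁺ Q Q∈B Q≉P
    ... | yes Q≈P = Secant-remove L (secant (on-respˡ Q P L Q≈P Q∈L))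

    remove-AffPoints : ∀ r → Tangent B r → P on r → B P ≡ true →
      AffPoints r (remove B P)
    remove-AffPoints r tangent P∈r P∈B Q Q∈B′ Q∈r =
      let Q∈B , Q≉P = remove⁻ Q Q∈B′ in Q≉P (Tangent-unique B r Q P tangent Q∈r Q∈B P∈r P∈B)

  insert : PSet → Pt → PSet
  insert S P X = S X ∨ ⌊ X ≟P P ⌋

  module _ (S : PSet) (P : Pt) where

    insert⁺ : ∀ Q → S Q ≡ true → insert S P Q ≡ true
    insert⁺ Q Q∈S rewrite Q∈S = ≡.refl

    insert-self : insert S P P ≡ true
    insert-self with P ≟P P
    ... | yes _   = ∨-zeroʳ (S P)
    ... | no P≉P = ⊥-elim (P≉P (≈P-refl P))

    insert⁻ : ∀ Q → insert S P Q ≡ true → S Q ≡ true ⊎ Q ≈P P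
    insert⁻ Q Q∈S′ with S Q | Q ≟P P
    ... | true  | _       = inj₁ ≡.refl
    ... | false | yes Q≈P = inj₂ Q≈P

    insert-Respects : Respects S → Respects (insert S P)
    insert-Respects resp X Y X≈Y = ≡.cong₂ _∨_ (resp X Y X≈Y) (≟P-congˡ P X Y X≈Y)

    insert-⊆ : ∀ B → Respects B → B P ≡ true → S ⊆ B → insert S P ⊆ B
    insert-⊆ B respB P∈B S⊆B X X∈S′ with insert⁻ X X∈S′
    ... | inj₁ X∈S = S⊆B X X∈S
    ... | inj₂ X≈P = ≡.trans (respB X P X≈P) P∈B

    insert-Meets : ∀ r → AffBlocking r S → P on r → ∀ L → Meets (insert S P) L
    insert-Meets r (_ , blocks) P∈r L with L ≟P r
    ... | yes L≈r = P , on-respʳ P r L (≈P-sym L r L≈r) P∈r , insert-self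
    ... | no L≉r  = let Q , Q∈L , _ , Q∈S = blocks L L≉r in Q , Q∈L , insert⁺ Q Q∈S

  AffBlocking-intro : ∀ r S → AffPoints r S →
    (∀ L → ¬ (L ≈P r) → Meets S L) → AffBlocking r S
  AffBlocking-intro r S affine meets = affine , λ L L≉r →
    let Q , Q∈L , Q∈S = meets L L≉r in Q , Q∈L , affine Q Q∈S , Q∈S

  ⊆-insert⇒remove-⊆ : ∀ B S P → B ⊆ insert S P → remove B P ⊆ S
  ⊆-insert⇒remove-⊆ B S P B⊆S′ Q Q∈B′ with remove⁻ B P Q Q∈B′
  ... | Q∈B , Q≉P with insert⁻ S P Q (B⊆S′ Q Q∈B)
  ...   | inj₁ Q∈S = Q∈S
  ...   | inj₂ Q≈P = ⊥-elim (Q≉P Q≈P)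

  Minimal⇒⊆insert : ∀ B P r S → Minimal B → Respects B → B P ≡ true → P on r →
    Respects S → S ⊆ B → AffBlocking r S → B ⊆ insert S P
  Minimal⇒⊆insert B P r S ((_ , noLine) , minimal) respB P∈B P∈r respS S⊆B blocks =
    minimal (insert S P) (insert-Respects S P respS) S′⊆B
      (insert-Meets S P r blocks P∈r , ¬ContainsLine-⊆ S′⊆B noLine)
    where
    S′⊆B : insert S P ⊆ B
    S′⊆B = insert-⊆ S P B respB P∈B S⊆B

lemma4p3 : ∀ {c ℓ : Level} (F : FiniteField c ℓ) → let open PG F in
    (B : PSet) → Respects B → Minimal B →
    (P : Pt) → B P ≡ true → (r : Line) → RInftyProperty B P r →
    AffMinimal r (remove B P)
lemma4p3 F B respB minB@((meets , _) , _) P P∈B r (P∈r , tangent , secants) =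
  AffBlocking-intro r (remove B P) (remove-AffPoints B P r tangent P∈r P∈B)
    (λ L L≉r → Meets-remove B P L (meets L) (λ P∈L → secants L P∈L L≉r))
  , λ S respS S⊆B′ blocks → ⊆-insert⇒remove-⊆ B S P
      (Minimal⇒⊆insert B P r S minB respB P∈B P∈r respS
         (λ X X∈S → remove-⊆ B P X (S⊆B′ X X∈S)) blocks)
  where
  open PG F
  open Projective F
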